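{- Let $x$ be a sequence of pairwise distinct integers of length $m$ and let $i,j\in\{1,\ldots,m-1\}$ with $i\neq j$. Then $\tau(x,i)\not\approx_{CT}\tau(x,j)$.
   Context: $\tau(x,i)$ is the sequence obtained from $x$ by exchanging $x[i]$ and $x[i+1]$. The Cartesian tree $C(x)$ of $x[1\ldots m]$: empty if $x$ is empty; otherwise its root corresponds to the position $g$ of the minimum of $x$, with left subtree $C(x[1\ldots g-1])$ and right subtree the Cartesian tree of $x[g+1\ldots m]$. $x\approx_{CT} y$ means $C(x)=C(y)$ (same binary tree shape). -}

module Defs where

open import Data.Nat using (ℕ; zero; suc)
open import Data.Integer using (ℤ; _≤?_)
open import Data.List using (List; []; _∷_; length)
open import Data.Product using (_×_; _,_)
open import Relation.Nullary using (yes; no)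
open import Relation.Binary.PropositionalEquality using (_≡_)

data Tree : Set where
  leaf : Tree
  node : Tree → Tree → Tree

swapAt0 : ℕ → List ℤ → List ℤ
swapAt0 zero    (a ∷ b ∷ xs) = b ∷ a ∷ xs
swapAt0 zero    xs           = xs
swapAt0 (suc k) []           = []
swapAt0 (suc k) (a ∷ xs)     = a ∷ swapAt0 k xs

-- τ(x,i): exchange x[i] and x[i+1], positions 1-based (i ≥ 1 in use).
τ : List ℤ → ℕ → List ℤ
τ x zero    = x
τ x (suc k) = swapAt0 k x

minimum : ℤ → List ℤ → ℤ
minimum a [] = a
minimum a (b ∷ xs) with a ≤? minimum b xs
... | yes _ = a
... | no  _ = minimum b xs

-- Split the nonempty list a ∷ xs at the position g of its minimum
-- (first occurrence): returns (x[1..g-1] , x[g+1..m]).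
splitMin : ℤ → List ℤ → List ℤ × List ℤ
splitMin a [] = [] , []
splitMin a (b ∷ xs) with a ≤? minimum b xs
... | yes _ = [] , (b ∷ xs)
... | no  _ with splitMin b xs
...   | (l , r) = (a ∷ l) , r

-- Cartesian tree with fuel (fuel ≥ length suffices; both parts are shorter).
cartesianF : ℕ → List ℤ → Tree
cartesianF _       []       = leaf
cartesianF zero    (_ ∷ _)  = leaf
cartesianF (suc n) (a ∷ xs) with splitMin a xs
... | (l , r) = node (cartesianF n l) (cartesianF n r)

C : List ℤ → Tree
C x = cartesianF (length x) x

_≈CT_ : List ℤ → List ℤ → Set
x ≈CT y = C x ≡ C y

{-# OPTIONS --safe #-}
-- The Cartesian tree of x determines its ascent pattern, the Boolean list
-- recording whether x[k] ≤ x[k+1] for each k: reading the tree in order,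
-- the last entry of a left subtree exceeds its root and the root is at most
-- the first entry of its right subtree. So it suffices that τ(x,i) and τ(x,j)
-- have different ascent patterns for i < j. They agree before position i. If
-- j > i+1, the comparison at i is between x[i] and x[i+1] in opposite orders.
-- If j = i+1, with (a,b,c) = (x[i],x[i+1],x[i+2]), equal patterns would force
-- b ≤ a ≤ c ≤ b or a < b < c < a, both impossible for distinct entries.
module Submission where

open import Defs
open import Data.Nat using (ℕ; _≤_; _+_)
open import Data.Integer using (ℤ)
open import Data.List using (List; length)
open import Data.List.Relation.Unary.Unique.Propositional using (Unique)
open import Relation.Nullary using (¬_)
open import Relation.Binary.PropositionalEquality using (_≡_)

open import Data.Bool using (Bool; true; false)
open import Data.Empty using (⊥)
import Data.Integer as ℤ
import Data.Integer.Properties as ℤₚ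
open import Data.List using ([]; _∷_; _++_; drop)
open import Data.List.Properties using (∷-injectiveˡ; ∷-injectiveʳ; length-++)
open import Data.List.Relation.Unary.All as All using (All; []; _∷_)
open import Data.List.Relation.Unary.AllPairs.Core using (_∷_)
open import Data.Nat using (zero; suc; _<_; s≤s; z≤n)
import Data.Nat.Properties as ℕₚ
open import Data.Product using (_,_; uncurry)
open import Relation.Binary.Bundles using (DecTotalOrder)
open import Relation.Binary.Definitions using (tri<; tri≈; tri>)
open import Relation.Binary.PropositionalEquality using (_≢_; refl; sym; trans; cong; cong₂; subst; module ≡-Reasoning)
open import Relation.Nullary using (does; yes; no)
open import Relation.Nullary.Decidable using (dec-true; dec-false)

module _ {o ℓ₁ ℓ₂} (O : DecTotalOrder o ℓ₁ ℓ₂) where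
  open DecTotalOrder O using (_≈_; _≤?_; antisym) renaming (trans to ≤-trans)
  open import Relation.Binary.Properties.DecTotalOrder O using (≰⇒≥)

  comparison-flips : ∀ {a b} → ¬ a ≈ b → does (b ≤? a) ≡ does (a ≤? b) → ⊥
  comparison-flips {a} {b} a≉b with b ≤? a | a ≤? b
  ... | yes b≤a | yes a≤b = λ _ → a≉b (antisym a≤b b≤a)
  ... | no  b≰a | no  a≰b = λ _ → b≰a (≰⇒≥ a≰b)
  ... | yes _   | no  _   = λ ()
  ... | no  _   | yes _   = λ ()

  no-comparison-cycle : ∀ {a b c} → ¬ a ≈ b →
    does (b ≤? a) ≡ does (a ≤? c) → does (a ≤? c) ≡ does (c ≤? b) → ⊥
  no-comparison-cycle {a} {b} {c} a≉b with b ≤? a | a ≤? c | c ≤? b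
  ... | yes b≤a | yes a≤c | yes c≤b = λ _ _ → a≉b (antisym (≤-trans a≤c c≤b) b≤a)
  ... | no  b≰a | no  a≰c | no  c≰b = λ _ _ → b≰a (≤-trans (≰⇒≥ c≰b) (≰⇒≥ a≰c))
  ... | yes _   | no  _   | _       = λ ()
  ... | no  _   | yes _   | _       = λ ()
  ... | _       | yes _   | no  _   = λ _ ()
  ... | _       | no  _   | yes _   = λ _ ()

ascents : List ℤ → List Bool
ascents (a ∷ b ∷ xs) = does (a ℤ.≤? b) ∷ ascents (b ∷ xs)
ascents _            = []

ascents-tail : ∀ a xs → drop 1 (ascents (a ∷ xs)) ≡ ascents xs
ascents-tail a []      = refl
ascents-tail a (_ ∷ _) = refl

edge : Bool → List ℤ → List Bool
edge _ []      = []
edge b (_ ∷ _) = b ∷ []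

ascents-from-min : ∀ {m} r → All (m ℤ.≤_) r → ascents (m ∷ r) ≡ edge true r ++ ascents r
ascents-from-min []      []          = refl
ascents-from-min (c ∷ r) (m≤c ∷ _) = cong (_∷ ascents (c ∷ r)) (dec-true (_ ℤ.≤? c) m≤c)

ascents-around-min : ∀ {m} l r → All (m ℤ.<_) l → All (m ℤ.≤_) r →
  ascents (l ++ m ∷ r) ≡ ascents l ++ edge false l ++ edge true r ++ ascents r
ascents-around-min []          r _             m≤r = ascents-from-min r m≤r
ascents-around-min (c ∷ [])    r (m<c ∷ _)     m≤r =
  cong₂ _∷_ (dec-false (c ℤ.≤? _) (ℤₚ.<⇒≱ m<c)) (ascents-from-min r m≤r)
ascents-around-min (c ∷ d ∷ l) r (_ ∷ m<d∷l) m≤r =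
  cong (does (c ℤ.≤? d) ∷_) (ascents-around-min (d ∷ l) r m<d∷l m≤r)

record MinSplit (x : List ℤ) (m : ℤ) (l r : List ℤ) : Set where
  field
    decomposition : x ≡ l ++ m ∷ r
    left-above    : All (m ℤ.<_) l
    right-above   : All (m ℤ.≤_) r

  ascents-decomposition : ascents x ≡ ascents l ++ edge false l ++ edge true r ++ ascents r
  ascents-decomposition =
    trans (cong ascents decomposition) (ascents-around-min l r left-above right-above)

  length-decomposition : length x ≡ length l + suc (length r)
  length-decomposition = trans (cong length decomposition) (length-++ l)

  left-shorter : length l < length x
  left-shorter = subst (length l <_) (sym length-decomposition) (ℕₚ.m<m+n (length l) (s≤s z≤n))

  right-shorter : length r < length x
  right-shorter = subst (length r <_) (sym length-decomposition) (ℕₚ.m≤n+m (suc (length r)) (length l))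

minimum-≤ : ∀ a xs → All (minimum a xs ℤ.≤_) (a ∷ xs)
minimum-≤ a []       = ℤₚ.≤-refl ∷ []
minimum-≤ a (b ∷ xs) with a ℤ.≤? minimum b xs
... | yes a≤m = ℤₚ.≤-refl ∷ All.map (ℤₚ.≤-trans a≤m) (minimum-≤ b xs)
... | no  a≰m = ℤₚ.<⇒≤ (ℤₚ.≰⇒> a≰m) ∷ minimum-≤ b xs

splitMin-minSplit : ∀ a xs → uncurry (MinSplit (a ∷ xs) (minimum a xs)) (splitMin a xs)
splitMin-minSplit a []       = record { decomposition = refl ; left-above = [] ; right-above = [] }
splitMin-minSplit a (b ∷ xs) with a ℤ.≤? minimum b xs
... | yes a≤m = record
  { decomposition = refl
  ; left-above    = []
  ; right-above   = All.map (ℤₚ.≤-trans a≤m) (minimum-≤ b xs)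
  }
... | no a≰m with splitMin b xs | splitMin-minSplit b xs
...   | _ , _ | s = record
  { decomposition = cong (a ∷_) decomposition
  ; left-above    = ℤₚ.≰⇒> a≰m ∷ left-above
  ; right-above   = right-above
  }
  where open MinSplit s

edgeᵀ : Bool → Tree → List Bool
edgeᵀ _ leaf       = []
edgeᵀ b (node _ _) = b ∷ []

ascentsᵀ : Tree → List Bool
ascentsᵀ leaf       = []
ascentsᵀ (node l r) = ascentsᵀ l ++ edgeᵀ false l ++ edgeᵀ true r ++ ascentsᵀ r

edgeᵀ-cartesianF : ∀ b n x → length x ≤ n → edgeᵀ b (cartesianF n x) ≡ edge b x
edgeᵀ-cartesianF b n       []       _  = refl
edgeᵀ-cartesianF b (suc n) (a ∷ xs) _  with splitMin a xs
... | _ , _ = refl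

ascentsᵀ-cartesianF : ∀ n x → length x ≤ n → ascentsᵀ (cartesianF n x) ≡ ascents x
ascentsᵀ-cartesianF n       []       _      = refl
ascentsᵀ-cartesianF (suc n) (a ∷ xs) |x|≤1+n with splitMin a xs | splitMin-minSplit a xs
... | l , r | s = begin
    ascentsᵀ (cartesianF n l) ++ edgeᵀ false (cartesianF n l)
      ++ edgeᵀ true (cartesianF n r) ++ ascentsᵀ (cartesianF n r)
  ≡⟨ cong₂ _++_ (ascentsᵀ-cartesianF n l |l|≤n)
       (cong₂ _++_ (edgeᵀ-cartesianF false n l |l|≤n)
         (cong₂ _++_ (edgeᵀ-cartesianF true n r |r|≤n) (ascentsᵀ-cartesianF n r |r|≤n))) ⟩
    ascents l ++ edge false l ++ edge true r ++ ascents r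
  ≡⟨ sym ascents-decomposition ⟩
    ascents (a ∷ xs)
  ∎
  where
  open ≡-Reasoning
  open MinSplit s
  |l|≤n : length l ≤ n
  |l|≤n = ℕₚ.m<1+n⇒m≤n (ℕₚ.<-≤-trans left-shorter |x|≤1+n)
  |r|≤n : length r ≤ n
  |r|≤n = ℕₚ.m<1+n⇒m≤n (ℕₚ.<-≤-trans right-shorter |x|≤1+n)

≈CT⇒ascents≡ : ∀ {x y} → x ≈CT y → ascents x ≡ ascents y
≈CT⇒ascents≡ {x} {y} Cx≡Cy = begin
  ascents x                  ≡⟨ sym (ascentsᵀ-cartesianF (length x) x ℕₚ.≤-refl) ⟩
  ascentsᵀ (C x)             ≡⟨ cong ascentsᵀ Cx≡Cy ⟩
  ascentsᵀ (C y)             ≡⟨ ascentsᵀ-cartesianF (length y) y ℕₚ.≤-refl ⟩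
  ascents y                  ∎
  where open ≡-Reasoning

ascents-swapAt0-≢ : ∀ k l x → k < l → k + 1 < length x → Unique x →
  ascents (swapAt0 k x) ≢ ascents (swapAt0 l x)
ascents-swapAt0-≢ zero _ (_ ∷ []) _ (s≤s ()) _
ascents-swapAt0-≢ zero (suc zero) (a ∷ b ∷ []) _ _ ((a≢b ∷ _) ∷ _) eq =
  comparison-flips ℤₚ.≤-decTotalOrder a≢b (∷-injectiveˡ eq)
ascents-swapAt0-≢ zero (suc zero) (a ∷ b ∷ c ∷ xs) _ _ ((a≢b ∷ _) ∷ _) eq =
  no-comparison-cycle ℤₚ.≤-decTotalOrder a≢b (∷-injectiveˡ eq) (∷-injectiveˡ (∷-injectiveʳ eq))
ascents-swapAt0-≢ zero (suc (suc l)) (a ∷ b ∷ xs) _ _ ((a≢b ∷ _) ∷ _) eq =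
  comparison-flips ℤₚ.≤-decTotalOrder a≢b (∷-injectiveˡ eq)
ascents-swapAt0-≢ (suc k) (suc l) (a ∷ xs) (s≤s k<l) (s≤s k+1<|xs|) (_ ∷ xs-unique) eq =
  ascents-swapAt0-≢ k l xs k<l k+1<|xs| xs-unique (begin
    ascents (swapAt0 k xs)                 ≡⟨ sym (ascents-tail a (swapAt0 k xs)) ⟩
    drop 1 (ascents (a ∷ swapAt0 k xs))    ≡⟨ cong (drop 1) eq ⟩
    drop 1 (ascents (a ∷ swapAt0 l xs))    ≡⟨ ascents-tail a (swapAt0 l xs) ⟩
    ascents (swapAt0 l xs)                 ∎)
  where open ≡-Reasoning

lemma11 : (x : List ℤ) → Unique x → (i j : ℕ) →
    1 ≤ i → i + 1 ≤ length x → 1 ≤ j → j + 1 ≤ length x → ¬ (i ≡ j) →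
    ¬ (τ x i ≈CT τ x j)
lemma11 x x-unique (suc k) (suc l) _ k+1<|x| _ l+1<|x| i≢j τᵢ≈τⱼ with ℕₚ.<-cmp k l
... | tri< k<l _ _ = ascents-swapAt0-≢ k l x k<l k+1<|x| x-unique (≈CT⇒ascents≡ τᵢ≈τⱼ)
... | tri≈ _ k≡l _ = i≢j (cong suc k≡l)
... | tri> _ _ l<k = ascents-swapAt0-≢ l k x l<k l+1<|x| x-unique (≈CT⇒ascents≡ (sym τᵢ≈τⱼ))
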